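{- If an instance of Minimum Multiway Cut is $4$-stable, then its LP relaxation (described in the context) is integral: every optimal LP solution satisfies $\bar u\in\{e_1,\dots,e_k\}$ for all $u\in V$.
   Context: Minimum Multiway Cut: given a graph $G=(V,E,w)$ with positive edge weights and terminals $s_1,\dots,s_k\in V$, find a partition $S_1,\dots,S_k$ of $V$ with $s_i\in S_i$ minimizing the total weight of edges whose endpoints lie in different parts (cut edges). The instance is $\gamma$-stable ($\gamma>1$) if, letting $\mathcal S^*$ be an optimal multiway cut with cut edge set $E^*$, every multiway cut $\mathcal S'\neq\mathcal S^*$ with cut edge set $E'$ satisfies $w(E'\setminus E^*)>\gamma\, w(E^*\setminus E')$ (equivalently, $\mathcal S^*$ is the unique optimal solution for every $G'=(V,E,w')$ with $w\le w'\le\gamma w$). LP relaxation: variables $\bar u\in\mathbb R^k$ for $u\in V$; minimize $\frac12\sum_{(u,v)\in E}w(u,v)\|\bar u-\bar v\|_1$ subject to $\bar s_i=e_i$ (standard basis vectors) and $\bar u\in\Delta=\{x:\|x\|_1=1,x\ge0\}$ for all $u$.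
   Formalization: The edge weights are positive rationals, and the LP variables $\bar u$ have rational entries, lying in ℚ^k rather than $\mathbb R^k$. -}

module Defs where

open import Data.Nat using (ℕ)
open import Data.Fin using (Fin; _≟_)
open import Data.List using (List; foldr; map; allFin)
open import Data.List.Relation.Unary.All using (All)
open import Data.Product using (_×_; _,_; proj₁; proj₂; Σ; ∃)
open import Data.Bool using (if_then_else_; not)
open import Relation.Nullary using (¬_; does)
open import Relation.Binary.PropositionalEquality using (_≡_)
open import Function.Definitions using (Injective)
open import Data.Rational using (ℚ; 0ℚ; 1ℚ; _+_; _-_; _*_; _≤_; _<_; ∣_∣; ½)

sumℚ : List ℚ → ℚ
sumℚ = foldr _+_ 0ℚ

Σℚ : (k : ℕ) → (Fin k → ℚ) → ℚ
Σℚ k f = sumℚ (map f (allFin k))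

record WGraph (n : ℕ) : Set where
  field
    edges   : List (Fin n × Fin n)
    weight  : Fin n × Fin n → ℚ
    weight+ : All (λ e → 0ℚ < weight e) edges
open WGraph public

record MWCInstance (n k : ℕ) : Set where
  field
    graph    : WGraph n
    terminal : Fin k → Fin n
    distinct : Injective _≡_ _≡_ terminal
open MWCInstance public

-- A multiway cut: a partition S₁ … S_k of V given by its part-labelling
-- (u ∈ S_i  iff  part u ≡ i), with s_i ∈ S_i.
MultiwayCut : ∀ {n k} → MWCInstance n k → Set
MultiwayCut {n} {k} I =
  Σ (Fin n → Fin k) λ part → ∀ i → part (terminal I i) ≡ i

part : ∀ {n k} {I : MWCInstance n k} → MultiwayCut I → Fin n → Fin k
part = proj₁

isCut : ∀ {n k} → (Fin n → Fin k) → Fin n × Fin n → Data.Bool.Bool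
isCut f (u , v) = not (does (f u ≟ f v))

-- Total weight of edges cut by S' but not by S (= w(E' \ E)).
cutDiffWeight : ∀ {n k} (I : MWCInstance n k) → MultiwayCut I → MultiwayCut I → ℚ
cutDiffWeight I S' S =
  sumℚ (map (λ e → if isCut (part {I = I} S') e
                    then (if isCut (part {I = I} S) e then 0ℚ else weight (graph I) e)
                    else 0ℚ)
            (edges (graph I)))

cutWeight : ∀ {n k} (I : MWCInstance n k) → MultiwayCut I → ℚ
cutWeight I S =
  sumℚ (map (λ e → if isCut (part {I = I} S) e then weight (graph I) e else 0ℚ)
            (edges (graph I)))

OptimalCut : ∀ {n k} (I : MWCInstance n k) → MultiwayCut I → Set
OptimalCut I S = ∀ (S' : MultiwayCut I) → cutWeight I S ≤ cutWeight I S'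

DifferentCut : ∀ {n k} {I : MWCInstance n k} → MultiwayCut I → MultiwayCut I → Set
DifferentCut {n} S' S = ∃ λ (u : Fin n) → ¬ (proj₁ S' u ≡ proj₁ S u)

Stable : ∀ {n k} → ℚ → MWCInstance n k → Set
Stable γ I =
  Σ (MultiwayCut I) λ S* → OptimalCut I S* ×
    (∀ (S' : MultiwayCut I) → DifferentCut {I = I} S' S* →
       γ * cutDiffWeight I S* S' < cutDiffWeight I S' S*)

basis : ∀ {k} → Fin k → Fin k → ℚ
basis i j = if does (i ≟ j) then 1ℚ else 0ℚ

LPPoint : ℕ → ℕ → Set
LPPoint n k = Fin n → Fin k → ℚ

LPFeasible : ∀ {n k} → MWCInstance n k → LPPoint n k → Set
LPFeasible {n} {k} I x =
  (∀ i j → x (terminal I i) j ≡ basis i j) ×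
  (∀ u j → 0ℚ ≤ x u j) ×
  (∀ u → Σℚ k (x u) ≡ 1ℚ)

dist₁ : ∀ {k} → (Fin k → ℚ) → (Fin k → ℚ) → ℚ
dist₁ {k} a b = Σℚ k (λ j → ∣ a j - b j ∣)

LPObjective : ∀ {n k} → MWCInstance n k → LPPoint n k → ℚ
LPObjective I x =
  ½ * sumℚ (map (λ e → weight (graph I) e * dist₁ (x (proj₁ e)) (x (proj₂ e)))
                 (edges (graph I)))

LPOptimal : ∀ {n k} → MWCInstance n k → LPPoint n k → Set
LPOptimal I x =
  LPFeasible I x × (∀ y → LPFeasible I y → LPObjective I x ≤ LPObjective I y)

Integral : ∀ {n k} → LPPoint n k → Set
Integral {n} {k} x = ∀ (u : Fin n) → ∃ λ (i : Fin k) → ∀ j → x u j ≡ basis i j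

-- Let S* be the stable optimal cut and x an optimal LP solution, and round x randomly: pick a part i
-- and a threshold t ∈ (0, 1], and move every vertex u with t ≤ x_u(i) to part i, leaving the others
-- in their S*-part.  By 4-stability every rounded cut S′ has w(E′ ∖ E*) − 4 w(E* ∖ E′) ≥ 0, with
-- strict inequality for a set of thresholds of positive length as soon as x_u(i) > 0 for some
-- i ≠ S*(u).  Summing over i and integrating over t edge by edge, an edge not cut by S* contributes
-- at most w ‖ū − v̄‖₁, and an edge cut by S* contributes −4w Σᵢ min(ūᵢ, v̄ᵢ) = w (2 ‖ū − v̄‖₁ − 4);
-- altogether at most 4 (LP(x) − w(E*)) ≤ 0.  Hence each ū is supported on its S*-part, so it is a
-- basis vector.  The rounded cut only changes when t crosses a coordinate of x, so the integrals
-- are exact finite sums over the sorted coordinates.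

{-# OPTIONS --safe #-}
module Submission where

open import Defs
open import Data.Bool using (Bool; true; false; if_then_else_; not; _∧_; _xor_)
open import Data.Empty using (⊥-elim)
open import Data.Fin using (Fin; zero; suc; _≟_)
open import Data.Fin.Properties using (all?; ¬∀⟶∃¬)
open import Data.Integer using (+_)
open import Data.List using (List; []; _∷_; map; allFin; concatMap)
open import Data.List.Membership.Propositional using (_∈_; lose)
open import Data.List.Membership.Propositional.Properties
  using (∈-map⁺; ∈-map⁻; ∈-concatMap⁺; ∈-concatMap⁻; ∈-allFin)
open import Data.List.Properties using (map-tabulate)
open import Data.List.Relation.Binary.Permutation.Propositional using (↭-sym)
open import Data.List.Relation.Binary.Permutation.Propositional.Properties using (∈-resp-↭)
open import Data.List.Relation.Unary.All as All using (All; []; _∷_)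
open import Data.List.Relation.Unary.Any using (Any; here; there; satisfied)
open import Data.List.Relation.Unary.Linked using (Linked; [-]; _∷_)
open import Data.Nat as ℕ using (ℕ)
open import Data.Product using (_×_; _,_; proj₁; proj₂)
open import Data.Rational
  using (ℚ; 0ℚ; 1ℚ; _+_; _-_; _*_; -_; _/_; _≤_; _<_; ∣_∣; ½; _⊓_; nonNegative; positive)
open import Data.Rational.Properties hiding (_≟_)
open import Data.Rational.Solver using (module +-*-Solver)
open import Data.List.Sort ≤-decTotalOrder using (sort; sort-↭; sort-↗)
open import Data.Sum using (inj₁; inj₂)
open import Function using (_∘_)
open import Function.Bundles using (mk⇔)
open import Relation.Binary.PropositionalEquality
open import Relation.Nullary using (¬_; Dec; yes; no; does)
open import Relation.Nullary.Decidable using (dec-true; dec-false; does-⇔; _×-dec_)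

open +-*-Solver

four two : ℚ
four = + 4 / 1
two  = + 2 / 1

indicator : Bool → ℚ
indicator b = if b then 1ℚ else 0ℚ

Sorted : List ℚ → Set
Sorted = Linked _≤_

sorted-≤ : ∀ {p ts a} → Sorted (p ∷ ts) → a ∈ ts → p ≤ a
sorted-≤ (p≤t ∷ _)      (here refl)  = p≤t
sorted-≤ (p≤t ∷ sorted) (there a∈ts) = ≤-trans p≤t (sorted-≤ sorted a∈ts)

sorted-cons : ∀ {p ts} → (∀ {a} → a ∈ ts → p ≤ a) → Sorted ts → Sorted (p ∷ ts)
sorted-cons {ts = []}     _    _      = [-]
sorted-cons {ts = t ∷ ts} p≤ts sorted = p≤ts (here refl) ∷ sorted

p≤q⇒0≤q-p : ∀ {p q} → p ≤ q → 0ℚ ≤ q - p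
p≤q⇒0≤q-p {p} {q} p≤q = subst (_≤ q - p) (+-inverseʳ p) (+-monoˡ-≤ (- p) p≤q)

p≤q⇒p-q≤0 : ∀ {p q} → p ≤ q → p - q ≤ 0ℚ
p≤q⇒p-q≤0 {p} {q} p≤q = subst (p - q ≤_) (+-inverseʳ q) (+-monoˡ-≤ (- q) p≤q)

p<q⇒0<q-p : ∀ {p q} → p < q → 0ℚ < q - p
p<q⇒0<q-p {p} {q} p<q = subst (_< q - p) (+-inverseʳ p) (+-monoˡ-< (- p) p<q)

p≡q⇒q-p≡0 : ∀ {p q} → p ≡ q → q - p ≡ 0ℚ
p≡q⇒q-p≡0 {p} refl = +-inverseʳ p

0≤p⇒0≤q⇒0≤p*q : ∀ {p q} → 0ℚ ≤ p → 0ℚ ≤ q → 0ℚ ≤ p * q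
0≤p⇒0≤q⇒0≤p*q {p} {q} 0≤p 0≤q =
  nonNegative⁻¹ (p * q) {{nonNeg*nonNeg⇒nonNeg p {{nonNegative 0≤p}} q {{nonNegative 0≤q}}}}

0<p⇒0<q⇒0<p*q : ∀ {p q} → 0ℚ < p → 0ℚ < q → 0ℚ < p * q
0<p⇒0<q⇒0<p*q {p} {q} 0<p 0<q = positive⁻¹ (p * q) {{pos*pos⇒pos p {{positive 0<p}} q {{positive 0<q}}}}

two*[p⊓q]+∣p-q∣≡p+q : ∀ p q → two * (p ⊓ q) + ∣ p - q ∣ ≡ p + q
two*[p⊓q]+∣p-q∣≡p+q p q with p ≤? q
... | yes p≤q = begin
  two * (p ⊓ q) + ∣ p - q ∣     ≡⟨ cong₂ (λ m d → two * m + d) (p≤q⇒p⊓q≡p p≤q) ∣p-q∣≡q-p ⟩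
  two * p + (q - p)             ≡⟨ solve 2 (λ p q → con two :* p :+ (q :- p) := p :+ q) refl p q ⟩
  p + q                         ∎
  where
  open ≡-Reasoning
  ∣p-q∣≡q-p : ∣ p - q ∣ ≡ q - p
  ∣p-q∣≡q-p = begin
    ∣ p - q ∣       ≡⟨ cong ∣_∣ (solve 2 (λ p q → p :- q := :- (q :- p)) refl p q) ⟩
    ∣ - (q - p) ∣   ≡⟨ ∣-p∣≡∣p∣ (q - p) ⟩
    ∣ q - p ∣       ≡⟨ 0≤p⇒∣p∣≡p (p≤q⇒0≤q-p p≤q) ⟩
    q - p           ∎
... | no p≰q = begin
  two * (p ⊓ q) + ∣ p - q ∣     ≡⟨ cong₂ (λ m d → two * m + d) (p≥q⇒p⊓q≡q q≤p) (0≤p⇒∣p∣≡p (p≤q⇒0≤q-p q≤p)) ⟩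
  two * q + (p - q)             ≡⟨ solve 2 (λ p q → con two :* q :+ (p :- q) := p :+ q) refl p q ⟩
  p + q                         ∎
  where
  open ≡-Reasoning
  q≤p : q ≤ p
  q≤p = ≮⇒≥ (λ p<q → p≰q (<⇒≤ p<q))

module _ {A : Set} where

  sumℚ-cong : ∀ {f g : A → ℚ} xs → (∀ a → f a ≡ g a) → sumℚ (map f xs) ≡ sumℚ (map g xs)
  sumℚ-cong []       f≗g = refl
  sumℚ-cong (x ∷ xs) f≗g = cong₂ _+_ (f≗g x) (sumℚ-cong xs f≗g)

  sumℚ-zero : ∀ xs → sumℚ (map (λ (_ : A) → 0ℚ) xs) ≡ 0ℚ
  sumℚ-zero []       = refl
  sumℚ-zero (x ∷ xs) = trans (+-identityˡ _) (sumℚ-zero xs)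

  sumℚ-+ : ∀ (f g : A → ℚ) xs → sumℚ (map (λ a → f a + g a) xs) ≡ sumℚ (map f xs) + sumℚ (map g xs)
  sumℚ-+ f g []       = refl
  sumℚ-+ f g (x ∷ xs) rewrite sumℚ-+ f g xs =
    solve 4 (λ a b s t → (a :+ b) :+ (s :+ t) := (a :+ s) :+ (b :+ t)) refl
      (f x) (g x) (sumℚ (map f xs)) (sumℚ (map g xs))

  sumℚ-* : ∀ c (f : A → ℚ) xs → sumℚ (map (λ a → c * f a) xs) ≡ c * sumℚ (map f xs)
  sumℚ-* c f []       = sym (*-zeroʳ c)
  sumℚ-* c f (x ∷ xs) rewrite sumℚ-* c f xs = sym (*-distribˡ-+ c (f x) (sumℚ (map f xs)))

  sumℚ-linear : ∀ c (f g : A → ℚ) xs →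
    sumℚ (map (λ a → f a - c * g a) xs) ≡ sumℚ (map f xs) - c * sumℚ (map g xs)
  sumℚ-linear c f g []       = solve 1 (λ c → con 0ℚ := con 0ℚ :- c :* con 0ℚ) refl c
  sumℚ-linear c f g (x ∷ xs) rewrite sumℚ-linear c f g xs =
    solve 5 (λ c a b s t → (a :- c :* b) :+ (s :- c :* t) := (a :+ s) :- c :* (b :+ t)) refl
      c (f x) (g x) (sumℚ (map f xs)) (sumℚ (map g xs))

  sumℚ-mono : ∀ {f g : A → ℚ} xs → All (λ a → f a ≤ g a) xs → sumℚ (map f xs) ≤ sumℚ (map g xs)
  sumℚ-mono []       []           = ≤-refl
  sumℚ-mono (x ∷ xs) (fx≤gx ∷ le) = +-mono-≤ fx≤gx (sumℚ-mono xs le)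

  sumℚ-nonneg : ∀ {f : A → ℚ} xs → (∀ a → 0ℚ ≤ f a) → 0ℚ ≤ sumℚ (map f xs)
  sumℚ-nonneg []       0≤f = ≤-refl
  sumℚ-nonneg (x ∷ xs) 0≤f = +-mono-≤ (0≤f x) (sumℚ-nonneg xs 0≤f)

  sumℚ-pos : ∀ {f : A → ℚ} xs → (∀ a → 0ℚ ≤ f a) → Any (λ a → 0ℚ < f a) xs → 0ℚ < sumℚ (map f xs)
  sumℚ-pos (x ∷ xs) 0≤f (here 0<fx)  = +-mono-<-≤ 0<fx (sumℚ-nonneg xs 0≤f)
  sumℚ-pos (x ∷ xs) 0≤f (there some) = +-mono-≤-< (0≤f x) (sumℚ-pos xs 0≤f some)

sumℚ-swap : ∀ {A B : Set} (f : A → B → ℚ) xs ys →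
  sumℚ (map (λ a → sumℚ (map (f a) ys)) xs) ≡ sumℚ (map (λ b → sumℚ (map (λ a → f a b) xs)) ys)
sumℚ-swap f []       ys = sym (sumℚ-zero ys)
sumℚ-swap f (x ∷ xs) ys rewrite sumℚ-swap f xs ys = sym (sumℚ-+ (f x) _ ys)

Σℚ-suc : ∀ k (f : Fin (ℕ.suc k) → ℚ) → Σℚ (ℕ.suc k) f ≡ f zero + Σℚ k (f ∘ suc)
Σℚ-suc k f =
  cong (λ xs → f zero + sumℚ xs) (trans (map-tabulate suc f) (sym (map-tabulate (λ j → j) (f ∘ suc))))

selected : ∀ {k} → Fin k → (Fin k → ℚ) → Fin k → ℚ
selected a f j = if does (a ≟ j) then f j else 0ℚ

Σℚ-select : ∀ {k} (a : Fin k) (f : Fin k → ℚ) → Σℚ k (selected a f) ≡ f a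
Σℚ-select {ℕ.suc k} zero f = begin
  Σℚ (ℕ.suc k) (selected zero f)    ≡⟨ Σℚ-suc k (selected zero f) ⟩
  f zero + Σℚ k (λ _ → 0ℚ)          ≡⟨ cong (λ s → f zero + s) (sumℚ-zero (allFin k)) ⟩
  f zero + 0ℚ                       ≡⟨ +-identityʳ (f zero) ⟩
  f zero                            ∎
  where open ≡-Reasoning
Σℚ-select {ℕ.suc k} (suc a) f =
  trans (Σℚ-suc k (selected (suc a) f)) (trans (+-identityˡ _) (Σℚ-select a (f ∘ suc)))

simplex-vertex : ∀ {k} {v : Fin k → ℚ} (a : Fin k) → Σℚ k v ≡ 1ℚ →
  (∀ j → ¬ a ≡ j → v j ≡ 0ℚ) → ∀ j → v j ≡ basis a j
simplex-vertex {k} {v} a Σv≡1 off-a j with a ≟ j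
... | no a≢j   = off-a j a≢j
... | yes refl = begin
  v a                                                ≡⟨ Σℚ-select a v ⟨
  Σℚ k (selected a v)     ≡⟨ sumℚ-cong (allFin k) on-a ⟩
  Σℚ k v                                             ≡⟨ Σv≡1 ⟩
  1ℚ                                                 ∎
  where
  open ≡-Reasoning
  on-a : ∀ j → selected a v j ≡ v j
  on-a j with a ≟ j
  ... | yes _   = refl
  ... | no a≢j  = sym (off-a j a≢j)

basis-sum : ∀ {k} (a : Fin k) → Σℚ k (basis a) ≡ 1ℚ
basis-sum a = Σℚ-select a (λ _ → 1ℚ)

basis-nonneg : ∀ {k} (a j : Fin k) → 0ℚ ≤ basis a j
basis-nonneg a j with does (a ≟ j)
... | true  = nonNegative⁻¹ 1ℚ
... | false = ≤-refl

basis-pos⇒≡ : ∀ {k} {a j : Fin k} → 0ℚ < basis a j → a ≡ j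
basis-pos⇒≡ {a = a} {j} 0<e with a ≟ j
... | yes a≡j = a≡j
... | no _    = ⊥-elim (<-irrefl refl 0<e)

dist₁-basis-refl : ∀ {k} (a : Fin k) → dist₁ (basis a) (basis a) ≡ 0ℚ
dist₁-basis-refl {k} a =
  trans (sumℚ-cong (allFin k) (λ j → cong ∣_∣ (+-inverseʳ (basis a j)))) (sumℚ-zero (allFin k))

dist₁-basis-≢ : ∀ {k} {a b : Fin k} → ¬ a ≡ b → dist₁ (basis a) (basis b) ≡ two
dist₁-basis-≢ {k} {a} {b} a≢b = begin
  dist₁ (basis a) (basis b)                      ≡⟨ sumℚ-cong (allFin k) disjoint ⟩
  Σℚ k (λ j → basis a j + basis b j)             ≡⟨ sumℚ-+ (basis a) (basis b) (allFin k) ⟩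
  Σℚ k (basis a) + Σℚ k (basis b)                ≡⟨ cong₂ _+_ (basis-sum a) (basis-sum b) ⟩
  two                                            ∎
  where
  open ≡-Reasoning
  disjoint : ∀ j → ∣ basis a j - basis b j ∣ ≡ basis a j + basis b j
  disjoint j with a ≟ j | b ≟ j
  ... | yes refl | yes refl = ⊥-elim (a≢b refl)
  ... | yes _    | no _     = refl
  ... | no _     | yes _    = refl
  ... | no _     | no _     = refl

simplex-overlap : ∀ {k} {p q : Fin k → ℚ} → Σℚ k p ≡ 1ℚ → Σℚ k q ≡ 1ℚ →
  two * Σℚ k (λ i → p i ⊓ q i) + dist₁ p q ≡ two
simplex-overlap {k} {p} {q} Σp≡1 Σq≡1 = begin
  two * Σℚ k (λ i → p i ⊓ q i) + dist₁ p q
    ≡⟨ cong (λ s → s + dist₁ p q) (sumℚ-* two (λ i → p i ⊓ q i) (allFin k)) ⟨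
  Σℚ k (λ i → two * (p i ⊓ q i)) + dist₁ p q
    ≡⟨ sumℚ-+ (λ i → two * (p i ⊓ q i)) (λ i → ∣ p i - q i ∣) (allFin k) ⟨
  Σℚ k (λ i → two * (p i ⊓ q i) + ∣ p i - q i ∣)
    ≡⟨ sumℚ-cong (allFin k) (λ i → two*[p⊓q]+∣p-q∣≡p+q (p i) (q i)) ⟩
  Σℚ k (λ i → p i + q i)
    ≡⟨ sumℚ-+ p q (allFin k) ⟩
  Σℚ k p + Σℚ k q
    ≡⟨ cong₂ _+_ Σp≡1 Σq≡1 ⟩
  two
    ∎
  where open ≡-Reasoning

-- The integral of h over (p, last ts] when h is constant on each interval between consecutive
-- points of p ∷ ts.
riemannSum : ℚ → List ℚ → (ℚ → ℚ) → ℚ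
riemannSum p []       h = 0ℚ
riemannSum p (t ∷ ts) h = (t - p) * h t + riemannSum t ts h

riemannSum-cong : ∀ p ts {g h : ℚ → ℚ} → (∀ t → g t ≡ h t) → riemannSum p ts g ≡ riemannSum p ts h
riemannSum-cong p []       g≗h = refl
riemannSum-cong p (t ∷ ts) g≗h = cong₂ (λ y s → (t - p) * y + s) (g≗h t) (riemannSum-cong t ts g≗h)

riemannSum-zero : ∀ p ts → riemannSum p ts (λ _ → 0ℚ) ≡ 0ℚ
riemannSum-zero p []       = refl
riemannSum-zero p (t ∷ ts) rewrite riemannSum-zero t ts | *-zeroʳ (t - p) = refl

riemannSum-+ : ∀ p ts (g h : ℚ → ℚ) →
  riemannSum p ts (λ t → g t + h t) ≡ riemannSum p ts g + riemannSum p ts h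
riemannSum-+ p []       g h = refl
riemannSum-+ p (t ∷ ts) g h rewrite riemannSum-+ t ts g h =
  solve 5 (λ d a b s r → d :* (a :+ b) :+ (s :+ r) := (d :* a :+ s) :+ (d :* b :+ r)) refl
    (t - p) (g t) (h t) (riemannSum t ts g) (riemannSum t ts h)

riemannSum-* : ∀ p ts c (h : ℚ → ℚ) → riemannSum p ts (λ t → c * h t) ≡ c * riemannSum p ts h
riemannSum-* p []       c h = sym (*-zeroʳ c)
riemannSum-* p (t ∷ ts) c h rewrite riemannSum-* t ts c h =
  solve 4 (λ d c a s → d :* (c :* a) :+ c :* s := c :* (d :* a :+ s)) refl (t - p) c (h t) (riemannSum t ts h)

riemannSum-linear : ∀ p ts c (g h : ℚ → ℚ) →
  riemannSum p ts (λ t → g t - c * h t) ≡ riemannSum p ts g - c * riemannSum p ts h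
riemannSum-linear p []       c g h = solve 1 (λ c → con 0ℚ := con 0ℚ :- c :* con 0ℚ) refl c
riemannSum-linear p (t ∷ ts) c g h rewrite riemannSum-linear t ts c g h =
  solve 6 (λ d c a b s r → d :* (a :- c :* b) :+ (s :- c :* r) := (d :* a :+ s) :- c :* (d :* b :+ r)) refl
    (t - p) c (g t) (h t) (riemannSum t ts g) (riemannSum t ts h)

riemannSum-sum : ∀ {A : Set} p ts (f : A → ℚ → ℚ) xs →
  riemannSum p ts (λ t → sumℚ (map (λ a → f a t) xs)) ≡ sumℚ (map (λ a → riemannSum p ts (f a)) xs)
riemannSum-sum p ts f []       = riemannSum-zero p ts
riemannSum-sum p ts f (x ∷ xs) =
  trans (riemannSum-+ p ts (f x) _) (cong (λ s → riemannSum p ts (f x) + s) (riemannSum-sum p ts f xs))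

riemannSum-mono : ∀ {p ts} {g h : ℚ → ℚ} → Sorted (p ∷ ts) → (∀ t → g t ≤ h t) →
  riemannSum p ts g ≤ riemannSum p ts h
riemannSum-mono {ts = []}     _            g≤h = ≤-refl
riemannSum-mono {p} {t ∷ ts} (p≤t ∷ sorted) g≤h =
  +-mono-≤ (*-monoˡ-≤-nonNeg (t - p) {{nonNegative (p≤q⇒0≤q-p p≤t)}} (g≤h t)) (riemannSum-mono sorted g≤h)

riemannSum-nonneg : ∀ {p ts} {h : ℚ → ℚ} → Sorted (p ∷ ts) → (∀ t → 0ℚ ≤ h t) → 0ℚ ≤ riemannSum p ts h
riemannSum-nonneg {p} {ts} sorted 0≤h =
  subst (_≤ riemannSum p ts _) (riemannSum-zero p ts) (riemannSum-mono sorted 0≤h)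

Reaches : ℚ → ℚ → Set
Reaches a t = 0ℚ < t × t ≤ a

reaches? : ∀ a t → Dec (Reaches a t)
reaches? a t = 0ℚ <? t ×-dec t ≤? a

χ : ℚ → ℚ → ℚ
χ a t = indicator (does (reaches? a t))

χ-reaches : ∀ {a t} → Reaches a t → χ a t ≡ 1ℚ
χ-reaches {a} {t} r = cong indicator (dec-true (reaches? a t) r)

χ-¬reaches : ∀ {a t} → ¬ Reaches a t → χ a t ≡ 0ℚ
χ-¬reaches {a} {t} ¬r = cong indicator (dec-false (reaches? a t) ¬r)

χ-⊓ : ∀ a b t → indicator (does (reaches? a t) ∧ does (reaches? b t)) ≡ χ (a ⊓ b) t
χ-⊓ a b t = cong indicator (does-⇔ (mk⇔ to from) (reaches? a t ×-dec reaches? b t) (reaches? (a ⊓ b) t))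
  where
  to : Reaches a t × Reaches b t → Reaches (a ⊓ b) t
  to ((0<t , t≤a) , (_ , t≤b)) = 0<t , ⊓-glb t≤a t≤b
  from : Reaches (a ⊓ b) t → Reaches a t × Reaches b t
  from (0<t , t≤a⊓b) = (0<t , ≤-trans t≤a⊓b (p⊓q≤p a b)) , (0<t , ≤-trans t≤a⊓b (p⊓q≤q a b))

width*χ≡0 : ∀ {p t a} → p ≤ t → a ≤ p → (t - p) * χ a t ≡ 0ℚ
width*χ≡0 {p} {t} {a} p≤t a≤p with reaches? a t
... | no ¬r          = trans (cong ((t - p) *_) (χ-¬reaches ¬r)) (*-zeroʳ (t - p))
... | yes r@(_ , t≤a) = trans (cong ((t - p) *_) (χ-reaches r))
                         (trans (*-identityʳ (t - p)) (p≡q⇒q-p≡0 (≤-antisym p≤t (≤-trans t≤a a≤p))))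

width*χ≡width : ∀ {p t a} → 0ℚ ≤ p → p ≤ t → t ≤ a → (t - p) * χ a t ≡ t - p
width*χ≡width {p} {t} {a} 0≤p p≤t t≤a with reaches? a t
... | yes r       = trans (cong ((t - p) *_) (χ-reaches r)) (*-identityʳ (t - p))
... | no ¬reaches = trans (cong ((t - p) *_) (χ-¬reaches ¬reaches))
                      (trans (*-zeroʳ (t - p)) (sym (p≡q⇒q-p≡0 (≤-antisym p≤t (≤-trans t≤0 0≤p)))))
  where
  t≤0 : t ≤ 0ℚ
  t≤0 = ≮⇒≥ (λ 0<t → ¬reaches (0<t , t≤a))

riemannSum-χ-vanish : ∀ {p ts a} → Sorted (p ∷ ts) → a ≤ p → riemannSum p ts (χ a) ≡ 0ℚ
riemannSum-χ-vanish {ts = []}     _              a≤p = refl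
riemannSum-χ-vanish {ts = t ∷ ts} (p≤t ∷ sorted) a≤p =
  cong₂ _+_ (width*χ≡0 p≤t a≤p) (riemannSum-χ-vanish sorted (≤-trans a≤p p≤t))

riemannSum-χ : ∀ {p ts a} → Sorted (p ∷ ts) → 0ℚ ≤ p → a ∈ ts → riemannSum p ts (χ a) ≡ a - p
riemannSum-χ {p} {a ∷ ts} {a} (p≤a ∷ sorted) 0≤p (here refl) =
  trans (cong₂ _+_ (width*χ≡width 0≤p p≤a ≤-refl) (riemannSum-χ-vanish sorted ≤-refl)) (+-identityʳ (a - p))
riemannSum-χ {p} {t ∷ ts} {a} (p≤t ∷ sorted) 0≤p (there a∈ts) =
  trans (cong₂ _+_ (width*χ≡width 0≤p p≤t (sorted-≤ sorted a∈ts)) (riemannSum-χ sorted (≤-trans 0≤p p≤t) a∈ts))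
    (solve 3 (λ p t a → (t :- p) :+ (a :- t) := a :- p) refl p t a)

riemannSum-pos : ∀ {p ts a} {h : ℚ → ℚ} → Sorted (p ∷ ts) → 0ℚ ≤ p → p < a → a ∈ ts →
  (∀ t → 0ℚ ≤ h t) → (∀ t → Reaches a t → 0ℚ < h t) → 0ℚ < riemannSum p ts h
riemannSum-pos {p} {a ∷ ts} {a} (_ ∷ sorted) 0≤p p<a (here refl) 0≤h pos =
  +-mono-<-≤ (0<p⇒0<q⇒0<p*q (p<q⇒0<q-p p<a) (pos a (≤-<-trans 0≤p p<a , ≤-refl))) (riemannSum-nonneg sorted 0≤h)
riemannSum-pos {p} {t ∷ ts} (p≤t ∷ sorted) 0≤p p<a (there a∈ts) 0≤h pos with p <? t
... | yes p<t = +-mono-<-≤ (0<p⇒0<q⇒0<p*q (p<q⇒0<q-p p<t) (pos t (≤-<-trans 0≤p p<t , sorted-≤ sorted a∈ts)))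
                  (riemannSum-nonneg sorted 0≤h)
... | no p≮t  = +-mono-≤-< (0≤p⇒0≤q⇒0≤p*q (p≤q⇒0≤q-p p≤t) (0≤h t))
                  (riemannSum-pos sorted (≤-trans 0≤p p≤t) (≤-<-trans (≮⇒≥ p≮t) p<a) a∈ts 0≤h pos)

riemannSum-χ₀ : ∀ {ts a} → Sorted (0ℚ ∷ ts) → a ∈ ts → riemannSum 0ℚ ts (χ a) ≡ a
riemannSum-χ₀ {a = a} sorted a∈ts = trans (riemannSum-χ sorted ≤-refl a∈ts) (+-identityʳ a)

indicator-xor : ∀ b c → indicator (b xor c) ≡ indicator b + indicator c - two * indicator (b ∧ c)
indicator-xor true  true  = refl
indicator-xor true  false = refl
indicator-xor false true  = refl
indicator-xor false false = refl

riemannSum-both : ∀ {ts a b} → Sorted (0ℚ ∷ ts) → a ∈ ts → b ∈ ts →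
  riemannSum 0ℚ ts (λ t → indicator (does (reaches? a t) ∧ does (reaches? b t))) ≡ a ⊓ b
riemannSum-both {ts} {a} {b} sorted a∈ts b∈ts =
  trans (riemannSum-cong 0ℚ ts (χ-⊓ a b)) (riemannSum-χ₀ sorted a⊓b∈ts)
  where
  a⊓b∈ts : a ⊓ b ∈ ts
  a⊓b∈ts with ⊓-sel a b
  ... | inj₁ a⊓b≡a = subst (_∈ ts) (sym a⊓b≡a) a∈ts
  ... | inj₂ a⊓b≡b = subst (_∈ ts) (sym a⊓b≡b) b∈ts

riemannSum-either : ∀ {ts a b} → Sorted (0ℚ ∷ ts) → a ∈ ts → b ∈ ts →
  riemannSum 0ℚ ts (λ t → indicator (does (reaches? a t) xor does (reaches? b t))) ≡ ∣ a - b ∣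
riemannSum-either {ts} {a} {b} sorted a∈ts b∈ts = begin
  riemannSum 0ℚ ts (λ t → indicator (reaches a t xor reaches b t))
    ≡⟨ riemannSum-cong 0ℚ ts (λ t → indicator-xor (reaches a t) (reaches b t)) ⟩
  riemannSum 0ℚ ts (λ t → χ a t + χ b t - two * both t)
    ≡⟨ riemannSum-linear 0ℚ ts two (λ t → χ a t + χ b t) both ⟩
  riemannSum 0ℚ ts (λ t → χ a t + χ b t) - two * riemannSum 0ℚ ts both
    ≡⟨ cong₂ (λ s m → s - two * m) (riemannSum-+ 0ℚ ts (χ a) (χ b)) (riemannSum-both sorted a∈ts b∈ts) ⟩
  riemannSum 0ℚ ts (χ a) + riemannSum 0ℚ ts (χ b) - two * (a ⊓ b)
    ≡⟨ cong₂ (λ x y → x + y - two * (a ⊓ b)) (riemannSum-χ₀ sorted a∈ts) (riemannSum-χ₀ sorted b∈ts) ⟩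
  a + b - two * (a ⊓ b)
    ≡⟨ cong (λ s → s - two * (a ⊓ b)) (two*[p⊓q]+∣p-q∣≡p+q a b) ⟨
  two * (a ⊓ b) + ∣ a - b ∣ - two * (a ⊓ b)
    ≡⟨ solve 2 (λ m d → con two :* m :+ d :- con two :* m := d) refl (a ⊓ b) ∣ a - b ∣ ⟩
  ∣ a - b ∣
    ∎
  where
  open ≡-Reasoning
  reaches : ℚ → ℚ → Bool
  reaches a t = does (reaches? a t)
  both : ℚ → ℚ
  both t = indicator (reaches a t ∧ reaches b t)

exclusiveWeight : Bool → Bool → ℚ → ℚ
exclusiveWeight c c′ w = if c then (if c′ then 0ℚ else w) else 0ℚ

exclusiveWeight-≤ : ∀ c c′ {w} → 0ℚ ≤ w → exclusiveWeight c c′ w ≤ w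
exclusiveWeight-≤ true  true  0≤w = 0≤w
exclusiveWeight-≤ true  false 0≤w = ≤-refl
exclusiveWeight-≤ false c′    0≤w = 0≤w

exclusiveWeight-refl : ∀ c w → exclusiveWeight c c w ≡ 0ℚ
exclusiveWeight-refl true  w = refl
exclusiveWeight-refl false w = refl

separated : ∀ {k} → Fin k → Fin k → Bool
separated a b = not (does (a ≟ b))

separated-refl : ∀ {k} (a : Fin k) → separated a a ≡ false
separated-refl a = cong not (dec-true (a ≟ a) refl)

separated-≢ : ∀ {k} {a b : Fin k} → ¬ a ≡ b → separated a b ≡ true
separated-≢ {a = a} {b} a≢b = cong not (dec-false (a ≟ b) a≢b)

-- The contribution of an edge with endpoint labels a, b to w(E′ ∖ E) − 4 w(E ∖ E′), when the cut
-- E′ arises by moving the first (second) endpoint to part i iff bu (bv).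
relabelGain : ∀ {k} → Fin k → Fin k → Fin k → Bool → Bool → ℚ → ℚ
relabelGain a b i bu bv w =
  exclusiveWeight (separated a′ b′) (separated a b) w
    - four * exclusiveWeight (separated a b) (separated a′ b′) w
  where
  a′ = if bu then i else a
  b′ = if bv then i else b

relabelGain-unseparated : ∀ {k} {a b : Fin k} i bu bv {w} → a ≡ b → 0ℚ ≤ w →
  relabelGain a b i bu bv w ≤ w * indicator (bu xor bv)
relabelGain-unseparated {a = a} i true true {w} refl 0≤w rewrite separated-refl i | separated-refl a =
  ≤-reflexive (sym (*-zeroʳ w))
relabelGain-unseparated {a = a} i true false {w} refl 0≤w rewrite separated-refl a = begin
  exclusiveWeight (separated i a) false w + 0ℚ   ≡⟨ +-identityʳ _ ⟩
  exclusiveWeight (separated i a) false w        ≤⟨ exclusiveWeight-≤ (separated i a) false 0≤w ⟩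
  w                                              ≡⟨ *-identityʳ w ⟨
  w * 1ℚ                                         ∎
  where open ≤-Reasoning
relabelGain-unseparated {a = a} i false true {w} refl 0≤w rewrite separated-refl a = begin
  exclusiveWeight (separated a i) false w + 0ℚ   ≡⟨ +-identityʳ _ ⟩
  exclusiveWeight (separated a i) false w        ≤⟨ exclusiveWeight-≤ (separated a i) false 0≤w ⟩
  w                                              ≡⟨ *-identityʳ w ⟨
  w * 1ℚ                                         ∎
  where open ≤-Reasoning
relabelGain-unseparated {a = a} i false false {w} refl 0≤w rewrite separated-refl a =
  ≤-reflexive (sym (*-zeroʳ w))

exclusiveWeight-gain-nonpos : ∀ s {w} → 0ℚ ≤ w → exclusiveWeight s true w - four * exclusiveWeight true s w ≤ 0ℚ
exclusiveWeight-gain-nonpos true  0≤w = ≤-refl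
exclusiveWeight-gain-nonpos false {w} 0≤w = begin
  0ℚ - four * w   ≡⟨ +-identityˡ _ ⟩
  - (four * w)    ≤⟨ neg-antimono-≤ (0≤p⇒0≤q⇒0≤p*q (nonNegative⁻¹ four) 0≤w) ⟩
  0ℚ              ∎
  where open ≤-Reasoning

relabelGain-separated : ∀ {k} {a b : Fin k} i bu bv {w} → ¬ a ≡ b → 0ℚ ≤ w →
  relabelGain a b i bu bv w ≤ - (four * w) * indicator (bu ∧ bv)
relabelGain-separated i true true {w} a≢b 0≤w rewrite separated-≢ a≢b | separated-refl i =
  ≤-reflexive (solve 1 (λ w → con 0ℚ :- con four :* w := :- (con four :* w) :* con 1ℚ) refl w)
relabelGain-separated {b = b} i true false {w} a≢b 0≤w rewrite separated-≢ a≢b =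
  ≤-trans (exclusiveWeight-gain-nonpos (separated i b) 0≤w) (≤-reflexive (sym (*-zeroʳ (- (four * w)))))
relabelGain-separated {a = a} i false true {w} a≢b 0≤w rewrite separated-≢ a≢b =
  ≤-trans (exclusiveWeight-gain-nonpos (separated a i) 0≤w) (≤-reflexive (sym (*-zeroʳ (- (four * w)))))
relabelGain-separated i false false {w} a≢b 0≤w rewrite separated-≢ a≢b =
  ≤-trans (exclusiveWeight-gain-nonpos true 0≤w) (≤-reflexive (sym (*-zeroʳ (- (four * w)))))

cutDiffWeight-same : ∀ {n k} (I : MWCInstance n k) (S S′ : MultiwayCut I) →
  (∀ u → part {I = I} S u ≡ part {I = I} S′ u) → cutDiffWeight I S S′ ≡ 0ℚ
cutDiffWeight-same I S S′ S≗S′ = trans (sumℚ-cong (edges (graph I)) same-cut) (sumℚ-zero (edges (graph I)))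
  where
  same-cut : ∀ e →
    exclusiveWeight (isCut (part {I = I} S) e) (isCut (part {I = I} S′) e) (weight (graph I) e) ≡ 0ℚ
  same-cut (u , v) =
    trans (cong₂ (λ a b → exclusiveWeight (separated a b) cut′ (weight (graph I) (u , v))) (S≗S′ u) (S≗S′ v))
          (exclusiveWeight-refl cut′ (weight (graph I) (u , v)))
    where cut′ = isCut (part {I = I} S′) (u , v)

module Rounding {n k} (I : MWCInstance n k) (S* : MultiwayCut I)
  (stable : ∀ S′ → DifferentCut {I = I} S′ S* → four * cutDiffWeight I S* S′ < cutDiffWeight I S′ S*)
  (x : LPPoint n k) (x-optimal : LPOptimal I x) where

  σ : Fin n → Fin k
  σ = part {I = I} S*

  E : List (Fin n × Fin n)
  E = edges (graph I)

  w : Fin n × Fin n → ℚ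
  w = weight (graph I)

  x-feasible : LPFeasible I x
  x-feasible = proj₁ x-optimal

  x-nonneg : ∀ u j → 0ℚ ≤ x u j
  x-nonneg = proj₁ (proj₂ x-feasible)

  x-sum : ∀ u → Σℚ k (x u) ≡ 1ℚ
  x-sum = proj₂ (proj₂ x-feasible)

  coordinates : List ℚ
  coordinates = concatMap (λ u → map (x u) (allFin k)) (allFin n)

  ∈-coordinates : ∀ u i → x u i ∈ coordinates
  ∈-coordinates u i = ∈-concatMap⁺ (λ u → map (x u) (allFin k)) (lose (∈-allFin u) (∈-map⁺ (x u) (∈-allFin i)))

  coordinates-nonneg : ∀ {a} → a ∈ coordinates → 0ℚ ≤ a
  coordinates-nonneg a∈ with satisfied (∈-concatMap⁻ (λ u → map (x u) (allFin k)) {xs = allFin n} a∈)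
  ... | u , a∈xu with ∈-map⁻ (x u) a∈xu
  ... | i , _ , refl = x-nonneg u i

  thresholds : List ℚ
  thresholds = sort coordinates

  ∈-thresholds : ∀ u i → x u i ∈ thresholds
  ∈-thresholds u i = ∈-resp-↭ (↭-sym (sort-↭ coordinates)) (∈-coordinates u i)

  thresholds-sorted : Sorted (0ℚ ∷ thresholds)
  thresholds-sorted =
    sorted-cons (λ a∈ → coordinates-nonneg (∈-resp-↭ (sort-↭ coordinates) a∈)) (sort-↗ coordinates)

  ∫ : (ℚ → ℚ) → ℚ
  ∫ = riemannSum 0ℚ thresholds

  moved : Fin k → ℚ → Fin n → Bool
  moved i t u = does (reaches? (x u i) t)

  roundLabel : Fin k → ℚ → Fin n → Fin k
  roundLabel i t u = if moved i t u then i else σ u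

  roundLabel-reaches : ∀ {i t u} → Reaches (x u i) t → roundLabel i t u ≡ i
  roundLabel-reaches {i} {t} {u} r = cong (λ b → if b then i else σ u) (dec-true (reaches? (x u i) t) r)

  roundLabel-¬reaches : ∀ {i t u} → ¬ Reaches (x u i) t → roundLabel i t u ≡ σ u
  roundLabel-¬reaches {i} {t} {u} ¬r = cong (λ b → if b then i else σ u) (dec-false (reaches? (x u i) t) ¬r)

  roundLabel-terminal : ∀ i t j → roundLabel i t (terminal I j) ≡ j
  roundLabel-terminal i t j with reaches? (x (terminal I j) i) t
  ... | yes r@(0<t , t≤x) =
    trans (roundLabel-reaches r)
          (sym (basis-pos⇒≡ (<-≤-trans 0<t (≤-trans t≤x (≤-reflexive (proj₁ x-feasible j i))))))
  ... | no ¬r = trans (roundLabel-¬reaches ¬r) (proj₂ S* j)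

  round : Fin k → ℚ → MultiwayCut I
  round i t = roundLabel i t , roundLabel-terminal i t

  gain : Fin k → ℚ → ℚ
  gain i t = cutDiffWeight I (round i t) S* - four * cutDiffWeight I S* (round i t)

  gain-nonneg : ∀ i t → 0ℚ ≤ gain i t
  gain-nonneg i t with all? (λ u → roundLabel i t u ≟ σ u)
  ... | yes same = ≤-reflexive (sym (cong₂ (λ d d′ → d - four * d′)
          (cutDiffWeight-same I (round i t) S* same)
          (cutDiffWeight-same I S* (round i t) (λ u → sym (same u)))))
  ... | no differ = <⇒≤ (p<q⇒0<q-p (stable (round i t) (¬∀⟶∃¬ n _ (λ u → roundLabel i t u ≟ σ u) differ)))

  gain-pos : ∀ {u i t} → ¬ σ u ≡ i → Reaches (x u i) t → 0ℚ < gain i t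
  gain-pos {u} {i} {t} σu≢i r =
    p<q⇒0<q-p (stable (round i t) (u , λ moved≡σu → σu≢i (trans (sym moved≡σu) (roundLabel-reaches r))))

  totalGain : ℚ
  totalGain = Σℚ k (λ i → ∫ (gain i))

  totalGain-pos : ∀ {u i} → ¬ σ u ≡ i → 0ℚ < x u i → 0ℚ < totalGain
  totalGain-pos {u} {i} σu≢i 0<x =
    sumℚ-pos (allFin k) (λ j → riemannSum-nonneg thresholds-sorted (gain-nonneg j))
      (lose (∈-allFin i) (riemannSum-pos thresholds-sorted ≤-refl 0<x (∈-thresholds u i) (gain-nonneg i)
                           (λ t → gain-pos σu≢i)))

  edgeGain : Fin k → ℚ → Fin n × Fin n → ℚ
  edgeGain i t (u , v) = relabelGain (σ u) (σ v) i (moved i t u) (moved i t v) (w (u , v))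

  gain≡ : ∀ i t → gain i t ≡ sumℚ (map (edgeGain i t) E)
  gain≡ i t = trans (sym (sumℚ-linear four cutOnlyBy cutOnlyBy* E)) (sumℚ-cong E λ { (u , v) → refl })
    where
    cutOnlyBy cutOnlyBy* : Fin n × Fin n → ℚ
    cutOnlyBy e  = exclusiveWeight (isCut (roundLabel i t) e) (isCut σ e) (w e)
    cutOnlyBy* e = exclusiveWeight (isCut σ e) (isCut (roundLabel i t) e) (w e)

  totalGain≡ : totalGain ≡ sumℚ (map (λ e → Σℚ k (λ i → ∫ (λ t → edgeGain i t e))) E)
  totalGain≡ = begin
    Σℚ k (λ i → ∫ (gain i))
      ≡⟨ sumℚ-cong (allFin k) (λ i → riemannSum-cong 0ℚ thresholds (gain≡ i)) ⟩
    Σℚ k (λ i → ∫ (λ t → sumℚ (map (edgeGain i t) E)))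
      ≡⟨ sumℚ-cong (allFin k) (λ i → riemannSum-sum 0ℚ thresholds (λ e t → edgeGain i t e) E) ⟩
    Σℚ k (λ i → sumℚ (map (λ e → ∫ (λ t → edgeGain i t e)) E))
      ≡⟨ sumℚ-swap (λ i e → ∫ (λ t → edgeGain i t e)) (allFin k) E ⟩
    sumℚ (map (λ e → Σℚ k (λ i → ∫ (λ t → edgeGain i t e))) E)
      ∎
    where open ≡-Reasoning

  ∫-unseparated : ∀ {u v} i → σ u ≡ σ v → 0ℚ ≤ w (u , v) →
    ∫ (λ t → edgeGain i t (u , v)) ≤ w (u , v) * ∣ x u i - x v i ∣
  ∫-unseparated {u} {v} i σu≡σv 0≤w = begin
    ∫ (λ t → edgeGain i t (u , v))
      ≤⟨ riemannSum-mono thresholds-sorted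
           (λ t → relabelGain-unseparated i (moved i t u) (moved i t v) σu≡σv 0≤w) ⟩
    ∫ (λ t → w (u , v) * indicator (moved i t u xor moved i t v))
      ≡⟨ riemannSum-* 0ℚ thresholds (w (u , v)) (λ t → indicator (moved i t u xor moved i t v)) ⟩
    w (u , v) * ∫ (λ t → indicator (moved i t u xor moved i t v))
      ≡⟨ cong (w (u , v) *_) (riemannSum-either thresholds-sorted (∈-thresholds u i) (∈-thresholds v i)) ⟩
    w (u , v) * ∣ x u i - x v i ∣
      ∎
    where open ≤-Reasoning

  ∫-separated : ∀ {u v} i → ¬ σ u ≡ σ v → 0ℚ ≤ w (u , v) →
    ∫ (λ t → edgeGain i t (u , v)) ≤ - (four * w (u , v)) * (x u i ⊓ x v i)
  ∫-separated {u} {v} i σu≢σv 0≤w = begin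
    ∫ (λ t → edgeGain i t (u , v))
      ≤⟨ riemannSum-mono thresholds-sorted
           (λ t → relabelGain-separated i (moved i t u) (moved i t v) σu≢σv 0≤w) ⟩
    ∫ (λ t → - (four * w (u , v)) * indicator (moved i t u ∧ moved i t v))
      ≡⟨ riemannSum-* 0ℚ thresholds (- (four * w (u , v))) (λ t → indicator (moved i t u ∧ moved i t v)) ⟩
    - (four * w (u , v)) * ∫ (λ t → indicator (moved i t u ∧ moved i t v))
      ≡⟨ cong (- (four * w (u , v)) *_)
              (riemannSum-both thresholds-sorted (∈-thresholds u i) (∈-thresholds v i)) ⟩
    - (four * w (u , v)) * (x u i ⊓ x v i)
      ∎
    where open ≤-Reasoning

  rounded : LPPoint n k
  rounded u = basis (σ u)

  rounded-feasible : LPFeasible I rounded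
  rounded-feasible =
    (λ i j → cong (λ a → basis a j) (proj₂ S* i)) , (λ u → basis-nonneg (σ u)) , (λ u → basis-sum (σ u))

  edgeCost : LPPoint n k → Fin n × Fin n → ℚ
  edgeCost y e = w e * dist₁ (y (proj₁ e)) (y (proj₂ e))

  edgeGain-bound-unseparated : ∀ {u v} → σ u ≡ σ v → 0ℚ ≤ w (u , v) →
    Σℚ k (λ i → ∫ (λ t → edgeGain i t (u , v))) ≤ two * edgeCost x (u , v) - two * edgeCost rounded (u , v)
  edgeGain-bound-unseparated {u} {v} σu≡σv 0≤w = begin
    Σℚ k (λ i → ∫ (λ t → edgeGain i t (u , v)))
      ≤⟨ sumℚ-mono (allFin k) (All.universal (λ i → ∫-unseparated i σu≡σv 0≤w) (allFin k)) ⟩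
    Σℚ k (λ i → W * ∣ x u i - x v i ∣)
      ≡⟨ sumℚ-* W (λ i → ∣ x u i - x v i ∣) (allFin k) ⟩
    W * D
      ≡⟨ +-identityʳ (W * D) ⟨
    W * D + 0ℚ
      ≤⟨ +-monoʳ-≤ (W * D) (0≤p⇒0≤q⇒0≤p*q 0≤w (sumℚ-nonneg (allFin k) (λ i → 0≤∣p∣ (x u i - x v i)))) ⟩
    W * D + W * D
      ≡⟨ solve 2 (λ W D → W :* D :+ W :* D := con two :* (W :* D) :- con two :* (W :* con 0ℚ)) refl W D ⟩
    two * (W * D) - two * (W * 0ℚ)
      ≡⟨ cong (λ d → two * (W * D) - two * (W * d)) (trans (cong (dist₁ (basis (σ u)) ∘ basis) (sym σu≡σv))
                                                             (dist₁-basis-refl (σ u))) ⟨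
    two * edgeCost x (u , v) - two * edgeCost rounded (u , v)
      ∎
    where
    open ≤-Reasoning
    W = w (u , v)
    D = dist₁ (x u) (x v)

  edgeGain-bound-separated : ∀ {u v} → ¬ σ u ≡ σ v → 0ℚ ≤ w (u , v) →
    Σℚ k (λ i → ∫ (λ t → edgeGain i t (u , v))) ≤ two * edgeCost x (u , v) - two * edgeCost rounded (u , v)
  edgeGain-bound-separated {u} {v} σu≢σv 0≤w = begin
    Σℚ k (λ i → ∫ (λ t → edgeGain i t (u , v)))
      ≤⟨ sumℚ-mono (allFin k) (All.universal (λ i → ∫-separated i σu≢σv 0≤w) (allFin k)) ⟩
    Σℚ k (λ i → - (four * W) * (x u i ⊓ x v i))
      ≡⟨ sumℚ-* (- (four * W)) (λ i → x u i ⊓ x v i) (allFin k) ⟩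
    - (four * W) * M
      ≡⟨ solve 3 (λ W M D → :- (con four :* W) :* M
                           := con two :* (W :* D) :- con two :* (W :* (con two :* M :+ D))) refl W M D ⟩
    two * (W * D) - two * (W * (two * M + D))
      ≡⟨ cong (λ s → two * (W * D) - two * (W * s)) (simplex-overlap {p = x u} {x v} (x-sum u) (x-sum v)) ⟩
    two * (W * D) - two * (W * two)
      ≡⟨ cong (λ d → two * (W * D) - two * (W * d)) (dist₁-basis-≢ σu≢σv) ⟨
    two * edgeCost x (u , v) - two * edgeCost rounded (u , v)
      ∎
    where
    open ≤-Reasoning
    W = w (u , v)
    M = Σℚ k (λ i → x u i ⊓ x v i)
    D = dist₁ (x u) (x v)

  totalGain-nonpos : totalGain ≤ 0ℚ
  totalGain-nonpos = begin
    totalGain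
      ≡⟨ totalGain≡ ⟩
    sumℚ (map (λ e → Σℚ k (λ i → ∫ (λ t → edgeGain i t e))) E)
      ≤⟨ sumℚ-mono E (All.map (λ 0<w → edgeGain-bound _ (<⇒≤ 0<w)) (weight+ (graph I))) ⟩
    sumℚ (map (λ e → two * edgeCost x e - two * edgeCost rounded e) E)
      ≡⟨ sumℚ-linear two (λ e → two * edgeCost x e) (edgeCost rounded) E ⟩
    sumℚ (map (λ e → two * edgeCost x e) E) - two * sumℚ (map (edgeCost rounded) E)
      ≡⟨ cong (_- two * sumℚ (map (edgeCost rounded) E)) (sumℚ-* two (edgeCost x) E) ⟩
    two * sumℚ (map (edgeCost x) E) - two * sumℚ (map (edgeCost rounded) E)
      ≤⟨ p≤q⇒p-q≤0 (*-monoˡ-≤-nonNeg two lp-bound) ⟩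
    0ℚ
      ∎
    where
    open ≤-Reasoning
    lp-bound : sumℚ (map (edgeCost x) E) ≤ sumℚ (map (edgeCost rounded) E)
    lp-bound = *-cancelˡ-≤-pos ½ (proj₂ x-optimal rounded rounded-feasible)
    edgeGain-bound : ∀ e → 0ℚ ≤ w e →
      Σℚ k (λ i → ∫ (λ t → edgeGain i t e)) ≤ two * edgeCost x e - two * edgeCost rounded e
    edgeGain-bound (u , v) 0≤w = by-cases (σ u ≟ σ v)
      where
      by-cases : Dec (σ u ≡ σ v) →
        Σℚ k (λ i → ∫ (λ t → edgeGain i t (u , v))) ≤ two * edgeCost x (u , v) - two * edgeCost rounded (u , v)
      by-cases (yes σu≡σv) = edgeGain-bound-unseparated σu≡σv 0≤w
      by-cases (no σu≢σv)  = edgeGain-bound-separated σu≢σv 0≤w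

  x-supported : ∀ u j → ¬ σ u ≡ j → x u j ≡ 0ℚ
  x-supported u j σu≢j = ≤-antisym
    (≮⇒≥ (λ 0<x → <-irrefl refl (<-≤-trans (totalGain-pos σu≢j 0<x) totalGain-nonpos)))
    (x-nonneg u j)

theorem2 : ∀ {n k : ℕ} (I : MWCInstance n k) → Stable (+ 4 / 1) I →
    ∀ (x : LPPoint n k) → LPOptimal I x → Integral x
theorem2 I (S* , _ , stable) x x-optimal u =  -- optimality of S* is implied by its stability
  σ u , simplex-vertex (σ u) (x-sum u) (x-supported u)
  where open Rounding I S* stable x x-optimal
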